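{- Let $\alpha=[0;a_1,a_2,\ldots]$ be irrational, with convergent denominators $q_n$, and run the doubling procedure (described in the context) on $\alpha$. Let $n\geq 2$. Then: (1) the state $(n,0)$ (window $(a_n,a_{n+1},a_{n+2})$) is visited if and only if $q_{n-2}$ is even; (2) the state $(n,1)$ (window $(a_n-1,a_{n+1},a_{n+2})$) is visited if and only if $q_{n-2}$ and $q_{n-1}$ are both odd; (3) index $n$ is skipped (i.e. neither $(n,0)$ nor $(n,1)$ is visited; equivalently the digit $2a_n$ was recorded in the step from state $(n-1,\delta)$) if and only if $q_{n-1}$ is even.
   Context: For $\alpha=[a_0;a_1,a_2,\ldots]$ the convergent denominators satisfy $q_0=1$, $q_1=a_1$, $q_{n+1}=a_{n+1}q_n+q_{n-1}$ for $n\geq 1$. Doubling procedure (Hurwitz's algorithm for computing $2\alpha$): it moves through states $(n,\delta)$ with $n\geq 1$ and $\delta\in\{0,1\}$, the state $(n,\delta)$ corresponding to the "window" $(a,b,c)=(a_n-\delta,a_{n+1},a_{n+2})$. It starts in state $(1,0)$. In state $(n,\delta)$ with $a=a_n-\delta$: if $a$ is even, it records the digits $a/2$ and $2a_{n+1}$ and moves to state $(n+2,0)$; if $a$ is odd, it records the digits $(a-1)/2,1,1$ and moves to state $(n+1,1)$. (After recording $2a_0$ first and deleting zeros by replacing each block $x,0,y$ by $x+y$, the recorded sequence gives the continued fraction of $2\alpha$, but this is not needed for the statement.) An index $n$ is said to be skipped if no state $(n,\delta)$ is visited. -}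

module Defs where

open import Data.Nat using (ℕ; zero; suc; _+_; _*_; _∸_)
open import Data.Nat.Divisibility using (_∣_)
open import Data.Bool using (Bool; true; false)
open import Relation.Nullary using (¬_)

Even : ℕ → Set
Even x = 2 ∣ x

Odd : ℕ → Set
Odd x = ¬ (2 ∣ x)

bit : Bool → ℕ
bit false = 0
bit true  = 1

q : (ℕ → ℕ) → ℕ → ℕ
q a zero = 1
q a (suc zero) = a 1
q a (suc (suc n)) = a (suc (suc n)) * q a (suc n) + q a n

data Visited (a : ℕ → ℕ) : ℕ → Bool → Set where
  start    : Visited a 1 false
  evenStep : ∀ {n δ} → Visited a n δ → Even (a n ∸ bit δ) → Visited a (suc (suc n)) false
  oddStep  : ∀ {n δ} → Visited a n δ → Odd (a n ∸ bit δ) → Visited a (suc n) true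

Skipped : (ℕ → ℕ) → ℕ → Set
Skipped a n = ¬ Visited a n false × ¬ Visited a n true
  where open import Data.Product using (_×_)

-- Write Q n = q_{n-1}, with q_{-1} = 0, so that Q (n+2) = a_{n+1} Q (n+1) + Q n for every n.
-- The state (n, δ) is visited exactly when q_{n-1} is odd and q_{n-2} ≡ δ (mod 2).
-- Under this invariant the window digit satisfies a_n - δ ≡ a_n q_{n-1} + q_{n-2} = q_n (mod 2):
-- an even digit makes q_n even, hence q_{n+1} ≡ q_{n-1} odd, matching the jump to (n+2, 0);
-- an odd digit makes q_n odd, matching the move to (n+1, 1). Conversely every n with q_{n-1}
-- odd is reached, by induction, because q_{n-1} odd and q_{n-2} even force q_{n-3} odd.
-- Since consecutive q's are coprime, never both even, the invariant yields (1)–(3).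
module Submission where

open import Defs
open import Data.Bool using (true; false)
open import Data.Nat using (ℕ; zero; suc; _+_; _*_; _≤_; _∸_; z≤n; s≤s; parity)
open import Data.Nat.Properties using (≤-trans; m∸n+n≡m)
open import Data.Nat.Divisibility using (divides; ∣-refl; ∣m∣n⇒∣m+n)
open import Data.Parity.Base as ℙ using (0ℙ; 1ℙ)
open import Data.Parity.Properties
  using (+-homo-+; *-homo-*; +-assoc; +-identityʳ; *-identityʳ; *-zeroʳ; p+p≡0ℙ; p≢p⁻¹)
open import Data.Product using (_×_; _,_; proj₁; proj₂; ∃-syntax)
open import Data.Empty using (⊥-elim)
open import Function.Bundles using (_⇔_; mk⇔)
open import Relation.Binary.PropositionalEquality
  using (_≡_; refl; sym; trans; cong; cong₂; module ≡-Reasoning)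
open import Relation.Nullary using (¬_)

open ≡-Reasoning

parity≡0ℙ⇒even : ∀ n → parity n ≡ 0ℙ → Even n
parity≡0ℙ⇒even zero          _ = divides 0 refl
parity≡0ℙ⇒even (suc (suc n)) p = ∣m∣n⇒∣m+n ∣-refl (parity≡0ℙ⇒even n p)

even⇒parity≡0ℙ : ∀ {n} → Even n → parity n ≡ 0ℙ
even⇒parity≡0ℙ (divides k refl) = trans (*-homo-* k 2) (*-zeroʳ (parity k))

parity≡1ℙ⇒odd : ∀ {n} → parity n ≡ 1ℙ → Odd n
parity≡1ℙ⇒odd p e = p≢p⁻¹ 0ℙ (trans (sym (even⇒parity≡0ℙ e)) p)

odd⇒parity≡1ℙ : ∀ n → Odd n → parity n ≡ 1ℙ
odd⇒parity≡1ℙ n o with parity n in p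
... | 0ℙ = ⊥-elim (o (parity≡0ℙ⇒even n p))
... | 1ℙ = refl

∸-homo-+ : ∀ {m n} → n ≤ m → parity (m ∸ n) ≡ parity m ℙ.+ parity n
∸-homo-+ {m} {n} n≤m = begin
  parity (m ∸ n)                                 ≡⟨ sym (+-identityʳ _) ⟩
  parity (m ∸ n) ℙ.+ 0ℙ                          ≡⟨ cong (parity (m ∸ n) ℙ.+_) (sym (p+p≡0ℙ (parity n))) ⟩
  parity (m ∸ n) ℙ.+ (parity n ℙ.+ parity n)     ≡⟨ sym (+-assoc (parity (m ∸ n)) (parity n) (parity n)) ⟩
  parity (m ∸ n) ℙ.+ parity n ℙ.+ parity n       ≡⟨ cong (ℙ._+ parity n) (sym (+-homo-+ (m ∸ n) n)) ⟩
  parity (m ∸ n + n) ℙ.+ parity n                ≡⟨ cong (λ k → parity k ℙ.+ parity n) (m∸n+n≡m n≤m) ⟩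
  parity m ℙ.+ parity n                          ∎

bit≤1 : ∀ δ → bit δ ≤ 1
bit≤1 false = z≤n
bit≤1 true  = s≤s z≤n

parity∘bit-surjective : ∀ p → ∃[ δ ] parity (bit δ) ≡ p
parity∘bit-surjective 0ℙ = false , refl
parity∘bit-surjective 1ℙ = true  , refl

Q : (ℕ → ℕ) → ℕ → ℕ
Q a zero    = 0
Q a (suc n) = q a n

module _ (a : ℕ → ℕ) where

  parity-Q-rec : ∀ m → parity (Q a (suc (suc m)))
                     ≡ parity (a (suc m)) ℙ.* parity (Q a (suc m)) ℙ.+ parity (Q a m)
  parity-Q-rec zero    = sym (trans (+-identityʳ _) (*-identityʳ _))
  parity-Q-rec (suc m) = trans (+-homo-+ (a (suc (suc m)) * q a (suc m)) (q a m))
                               (cong (ℙ._+ parity (q a m)) (*-homo-* (a (suc (suc m))) (q a (suc m))))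

  parity-Q-skip : ∀ m → parity (Q a (suc m)) ≡ 0ℙ → parity (Q a (suc (suc m))) ≡ parity (Q a m)
  parity-Q-skip m even = begin
    parity (Q a (suc (suc m)))                                      ≡⟨ parity-Q-rec m ⟩
    parity (a (suc m)) ℙ.* parity (Q a (suc m)) ℙ.+ parity (Q a m)  ≡⟨ cong (λ p → parity (a (suc m)) ℙ.* p ℙ.+ parity (Q a m)) even ⟩
    parity (a (suc m)) ℙ.* 0ℙ ℙ.+ parity (Q a m)                    ≡⟨ cong (ℙ._+ parity (Q a m)) (*-zeroʳ (parity (a (suc m)))) ⟩
    parity (Q a m)                                                  ∎

  parity-Q-suc≡1ℙ : ∀ m → parity (Q a m) ≡ 0ℙ → parity (Q a (suc m)) ≡ 1ℙ
  parity-Q-suc≡1ℙ zero    _    = refl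
  parity-Q-suc≡1ℙ (suc m) even with parity (Q a m) in prev
  ... | 0ℙ = ⊥-elim (p≢p⁻¹ 0ℙ (trans (sym even) (parity-Q-suc≡1ℙ m prev)))
  ... | 1ℙ = trans (parity-Q-skip m even) prev

module _ (a : ℕ → ℕ) (a-pos : ∀ k → 1 ≤ a (suc k)) where

  window-parity : ∀ m δ → parity (Q a (suc m)) ≡ 1ℙ → parity (Q a m) ≡ parity (bit δ) →
                  parity (a (suc m) ∸ bit δ) ≡ parity (Q a (suc (suc m)))
  window-parity m δ odd prev = begin
    parity (a (suc m) ∸ bit δ)                                      ≡⟨ ∸-homo-+ (≤-trans (bit≤1 δ) (a-pos m)) ⟩
    parity (a (suc m)) ℙ.+ parity (bit δ)                           ≡⟨ cong₂ ℙ._+_ (sym (*-identityʳ (parity (a (suc m))))) (sym prev) ⟩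
    parity (a (suc m)) ℙ.* 1ℙ ℙ.+ parity (Q a m)                    ≡⟨ cong (λ p → parity (a (suc m)) ℙ.* p ℙ.+ parity (Q a m)) (sym odd) ⟩
    parity (a (suc m)) ℙ.* parity (Q a (suc m)) ℙ.+ parity (Q a m)  ≡⟨ sym (parity-Q-rec a m) ⟩
    parity (Q a (suc (suc m)))                                      ∎

  visited⇒parities : ∀ {n δ} → Visited a n δ →
                     parity (Q a n) ≡ 1ℙ × parity (Q a (n ∸ 1)) ≡ parity (bit δ)
  visited⇒parities start = refl , refl
  visited⇒parities (evenStep {zero} v _) with visited⇒parities v
  ... | () , _
  visited⇒parities (evenStep {suc m} {δ} v even) with visited⇒parities v
  ... | odd , prev = trans (parity-Q-skip a (suc m) digit) odd , digit
    where
    digit : parity (Q a (suc (suc m))) ≡ 0ℙ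
    digit = trans (sym (window-parity m δ odd prev)) (even⇒parity≡0ℙ even)
  visited⇒parities (oddStep {zero} v _) with visited⇒parities v
  ... | () , _
  visited⇒parities (oddStep {suc m} {δ} v odd-digit) with visited⇒parities v
  ... | odd , prev = trans (sym (window-parity m δ odd prev)) (odd⇒parity≡1ℙ _ odd-digit) , odd

  parities⇒visited : ∀ n δ → parity (Q a (suc n)) ≡ 1ℙ → parity (Q a n) ≡ parity (bit δ) →
                     Visited a (suc n) δ
  parities⇒visited zero          false _ _  = start
  parities⇒visited zero          true  _ ()
  parities⇒visited (suc zero)    false _ ()
  parities⇒visited (suc n) true odd odd-prev with parity∘bit-surjective (parity (Q a n))
  ... | δ , prev = oddStep (parities⇒visited n δ odd-prev (sym prev))
                           (parity≡1ℙ⇒odd (trans (window-parity n δ odd-prev (sym prev)) odd))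
  parities⇒visited (suc (suc n)) false odd even with parity∘bit-surjective (parity (Q a n))
  ... | δ , prev = evenStep (parities⇒visited n δ odd′ (sym prev))
                            (parity≡0ℙ⇒even _ (trans (window-parity n δ odd′ (sym prev)) even))
    where
    odd′ : parity (Q a (suc n)) ≡ 1ℙ
    odd′ = trans (sym (parity-Q-skip a (suc n) even)) odd

  visited-false⇔even : ∀ k → Visited a (suc k) false ⇔ Even (Q a k)
  visited-false⇔even k = mk⇔
    (λ v → parity≡0ℙ⇒even _ (proj₂ (visited⇒parities v)))
    (λ e → let even = even⇒parity≡0ℙ e in
           parities⇒visited k false (parity-Q-suc≡1ℙ a k even) even)

  visited-true⇔odd×odd : ∀ k → Visited a (suc k) true ⇔ (Odd (Q a k) × Odd (Q a (suc k)))
  visited-true⇔odd×odd k = mk⇔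
    (λ v → let (odd , prev) = visited⇒parities v in parity≡1ℙ⇒odd prev , parity≡1ℙ⇒odd odd)
    (λ (o , o′) → parities⇒visited k true (odd⇒parity≡1ℙ _ o′) (odd⇒parity≡1ℙ _ o))

  skipped⇔even : ∀ k → Skipped a (suc k) ⇔ Even (Q a (suc k))
  skipped⇔even k = mk⇔ to (λ e → unvisited e , unvisited e)
    where
    unvisited : ∀ {δ} → Even (Q a (suc k)) → ¬ Visited a (suc k) δ
    unvisited e v = p≢p⁻¹ 0ℙ (trans (sym (even⇒parity≡0ℙ e)) (proj₁ (visited⇒parities v)))

    to : Skipped a (suc k) → Even (Q a (suc k))
    to (¬v₀ , ¬v₁) with parity (Q a (suc k)) in p | parity∘bit-surjective (parity (Q a k))
    ... | 0ℙ | _          = parity≡0ℙ⇒even _ p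
    ... | 1ℙ | false , eq = ⊥-elim (¬v₀ (parities⇒visited k false p (sym eq)))
    ... | 1ℙ | true  , eq = ⊥-elim (¬v₁ (parities⇒visited k true p (sym eq)))

lemma5p5 : (a : ℕ → ℕ) → a 0 ≡ 0 → (∀ k → 1 ≤ a (suc k)) →
    ∀ n → 2 ≤ n →
      (Visited a n false ⇔ Even (q a (n ∸ 2)))
      × (Visited a n true ⇔ (Odd (q a (n ∸ 2)) × Odd (q a (n ∸ 1))))
      × (Skipped a n ⇔ Even (q a (n ∸ 1)))
lemma5p5 a _ a-pos (suc (suc k)) (s≤s (s≤s _)) =
    visited-false⇔even a a-pos (suc k)
  , visited-true⇔odd×odd a a-pos (suc k)
  , skipped⇔even a a-pos (suc k)
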